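{- Let $G=(V,E)$ be a DAG with topological order $v_1,\ldots,v_{|V|}$, let $i\in\{1,\ldots,|V|\}$, and for $t\in\{0,\ldots,|V|\}$ let $S_t$ be the support of $G_t=G[\{v_1,\ldots,v_t\}]$. Then for every $u\in S_{i-1}$: $u$ reaches $v_i$ if and only if either $(u,v_i)\in E$, or there exists an edge $(v_j,v_i)\in E$ such that $u\in S_{i-1}\cap S_{j-1}$ and $u$ reaches $v_j$. Consequently, the procedure that, for each $u\in S_{i-1}$, marks $u$ as reaching $v_i$ exactly when one of these two conditions holds (using the known reachability from $S_{j-1}$ to $v_j$ for each in-neighbor $v_j$ of $v_i$) correctly computes which vertices of $S_{i-1}$ reach $v_i$.
   Context: A topological order is an ordering of the vertices such that every edge goes from an earlier to a later vertex; $G_0$ is the empty graph. In a directed graph $H$, $u$ reaches $v$ if there is a path (sequence of distinct vertices, consecutive ones joined by edges of $H$, at least one vertex) from $u$ to $v$ in $H$. An antichain of $H$ is a set of vertices no one of which reaches a different one in $H$. A set $A$ reaches $v$ if some $u\in A$ reaches $v$. For antichains $A,B$ of $H$ of the same size, $B$ dominates $A$ (in $H$) if for every $b\in B$, $A$ reaches $b$ in $H$; antichains of different sizes are not related. An $H$-frontier antichain is an antichain of $H$ not dominated in $H$ by any other antichain of $H$. The support $S_t$ of $G_t$ is the union of all $G_t$-frontier antichains. -}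

module Defs where

open import Data.Nat using (ℕ; suc; _<_)
open import Data.Fin using (Fin; toℕ)
open import Data.Fin.Subset using (Subset; _∈_; ∣_∣)
open import Data.Product using (Σ; ∃; _×_)
open import Data.Sum using (_⊎_)
open import Relation.Nullary using (¬_)
open import Relation.Binary.PropositionalEquality using (_≡_; _≢_)

-- A directed graph on the vertex set {v_0,...,v_{n-1}} (0-based, identified
-- with Fin n); the vertex order is the given topological order.
Graph : ℕ → Set₁
Graph n = Fin n → Fin n → Set

IsTopOrder : ∀ {n} → Graph n → Set
IsTopOrder {n} E = ∀ (a b : Fin n) → E a b → toℕ a < toℕ b

module _ {n : ℕ} (E : Graph n) where

  -- G_t = G[{v_1,...,v_t}] : in 0-based indexing, the vertices x with toℕ x < t.
  InG : ℕ → Fin n → Set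
  InG t x = toℕ x < t

  data Reaches (t : ℕ) : Fin n → Fin n → Set where
    here : ∀ {u} → InG t u → Reaches t u u
    step : ∀ {u w v} → InG t u → E u w → Reaches t w v → Reaches t u v

  SetReaches : ℕ → Subset n → Fin n → Set
  SetReaches t A v = ∃ λ a → a ∈ A × Reaches t a v

  Antichain : ℕ → Subset n → Set
  Antichain t A =
    (∀ x → x ∈ A → InG t x) ×
    (∀ a b → a ∈ A → b ∈ A → a ≢ b → ¬ Reaches t a b)

  Dominates : ℕ → Subset n → Subset n → Set
  Dominates t B A = (∣ A ∣ ≡ ∣ B ∣) × (∀ b → b ∈ B → SetReaches t A b)

  Frontier : ℕ → Subset n → Set
  Frontier t A =
    Antichain t A × (∀ B → Antichain t B → B ≢ A → ¬ Dominates t B A)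

  Support : ℕ → Fin n → Set
  Support t u = ∃ λ A → Frontier t A × u ∈ A

-- A G_t-frontier antichain A restricts to a G_s-frontier antichain A ∩ V(G_s) for
-- every s ≤ t: if an antichain B of G_s dominated A ∩ V(G_s), then B together with
-- the part of A outside G_s would be an antichain of G_t dominating A.  Hence
-- S_t ∩ V(G_s) ⊆ S_s.  Now let u ∈ S_{i-1} reach v_i.  A path from u to v_i ends
-- with an edge (v_j, v_i); either u = v_j, or u precedes v_j in the topological
-- order, so u ∈ S_{i-1} ∩ V(G_{j-1}) ⊆ S_{j-1}.
module Submission where

open import Defs
open import Data.Nat using (ℕ; suc; _+_; _<_; _≤_; _<ᵇ_)
open import Data.Nat.Properties using (≤-refl; <⇒≤; <-≤-trans; ≤-<-trans; <-irrefl; +-suc; <ᵇ⇒<; <⇒<ᵇ)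
open import Data.Fin using (Fin; toℕ; zero; suc)
open import Data.Fin.Properties using (toℕ<n)
open import Data.Fin.Subset using (Subset; _∈_; _⊆_; _∩_; _∪_; ∁; ∣_∣; Empty; inside; outside)
open import Data.Fin.Subset.Properties
  using (⊆-antisym; x∈p∩q⁺; x∈p∩q⁻; x∈p∪q⁺; x∈p∪q⁻; x∈∁p⇒x∉p)
open import Data.Vec using ([]; _∷_; tabulate; here; there)
open import Data.Vec.Properties using (lookup∘tabulate; []=⇒lookup; lookup⇒[]=)
open import Data.Bool.Properties using (T-≡)
open import Data.Product using (∃; _×_; _,_; proj₁; proj₂)
open import Data.Sum using (_⊎_; inj₁; inj₂)
open import Function using (_∘_)
open import Function.Bundles using (_⇔_; mk⇔; Equivalence)
open import Relation.Nullary using (¬_; contradiction)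
open import Relation.Binary.PropositionalEquality using (_≡_; _≢_; refl; sym; trans; cong; subst; module ≡-Reasoning)

private
  variable
    m : ℕ

∣p∣≡∣p∩q∣+∣p∩∁q∣ : (p q : Subset m) → ∣ p ∣ ≡ ∣ p ∩ q ∣ + ∣ p ∩ ∁ q ∣
∣p∣≡∣p∩q∣+∣p∩∁q∣ []            []            = refl
∣p∣≡∣p∩q∣+∣p∩∁q∣ (inside  ∷ p) (inside  ∷ q) = cong suc (∣p∣≡∣p∩q∣+∣p∩∁q∣ p q)
∣p∣≡∣p∩q∣+∣p∩∁q∣ (inside  ∷ p) (outside ∷ q) =
  trans (cong suc (∣p∣≡∣p∩q∣+∣p∩∁q∣ p q)) (sym (+-suc _ _))
∣p∣≡∣p∩q∣+∣p∩∁q∣ (outside ∷ p) (_       ∷ q) = ∣p∣≡∣p∩q∣+∣p∩∁q∣ p q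

Empty-∩-tail : ∀ x y (p q : Subset m) → Empty ((x ∷ p) ∩ (y ∷ q)) → Empty (p ∩ q)
Empty-∩-tail _ _ _ _ disjoint (x , x∈p∩q) = disjoint (suc x , there x∈p∩q)

∣p∪q∣≡∣p∣+∣q∣ : (p q : Subset m) → Empty (p ∩ q) → ∣ p ∪ q ∣ ≡ ∣ p ∣ + ∣ q ∣
∣p∪q∣≡∣p∣+∣q∣ []            []            _        = refl
∣p∪q∣≡∣p∣+∣q∣ (inside  ∷ p) (inside  ∷ q) disjoint = contradiction (zero , here) disjoint
∣p∪q∣≡∣p∣+∣q∣ (inside  ∷ p) (outside ∷ q) disjoint =
  cong suc (∣p∪q∣≡∣p∣+∣q∣ p q (Empty-∩-tail inside outside p q disjoint))
∣p∪q∣≡∣p∣+∣q∣ (outside ∷ p) (inside  ∷ q) disjoint =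
  trans (cong suc (∣p∪q∣≡∣p∣+∣q∣ p q (Empty-∩-tail outside inside p q disjoint))) (sym (+-suc _ _))
∣p∪q∣≡∣p∣+∣q∣ (outside ∷ p) (outside ∷ q) disjoint =
  ∣p∪q∣≡∣p∣+∣q∣ p q (Empty-∩-tail outside outside p q disjoint)

Prefix : ℕ → Subset m
Prefix s = tabulate λ x → toℕ x <ᵇ s

∈Prefix⁺ : ∀ {s} {x : Fin m} → toℕ x < s → x ∈ Prefix s
∈Prefix⁺ {s = s} {x = x} x<s =
  lookup⇒[]= x _ (trans (lookup∘tabulate _ x) (Equivalence.to (T-≡ {toℕ x <ᵇ s}) (<⇒<ᵇ x<s)))

∈Prefix⁻ : ∀ {s} {x : Fin m} → x ∈ Prefix s → toℕ x < s
∈Prefix⁻ {s = s} {x = x} x∈P =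
  <ᵇ⇒< (toℕ x) s (Equivalence.from T-≡ (trans (sym (lookup∘tabulate _ x)) ([]=⇒lookup x∈P)))

module _ {n : ℕ} (E : Graph n) where

  Reaches-weaken : ∀ {s t u v} → s ≤ t → Reaches E s u v → Reaches E t u v
  Reaches-weaken s≤t (here u<s)     = here (<-≤-trans u<s s≤t)
  Reaches-weaken s≤t (step u<s e r) = step (<-≤-trans u<s s≤t) e (Reaches-weaken s≤t r)

  Reaches-trans : ∀ {t u w v} → Reaches E t u w → Reaches E t w v → Reaches E t u v
  Reaches-trans (here _)       r′ = r′
  Reaches-trans (step u<t e r) r′ = step u<t e (Reaches-trans r r′)

  Reaches⇒≡⊎lastEdge : ∀ {t u v} → Reaches E t u v →
                        u ≡ v ⊎ ∃ λ j → Reaches E t u j × E j v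
  Reaches⇒≡⊎lastEdge (here _) = inj₁ refl
  Reaches⇒≡⊎lastEdge (step {u} u<t e r) with Reaches⇒≡⊎lastEdge r
  ... | inj₁ refl          = inj₂ (u , here u<t , e)
  ... | inj₂ (j , r′ , e′) = inj₂ (j , step u<t e r′ , e′)

  Antichain-restrict : ∀ {s t A} → s ≤ t → Antichain E t A → Antichain E s (A ∩ Prefix s)
  Antichain-restrict s≤t (_ , incomparable) =
    (λ x x∈Aₛ → ∈Prefix⁻ (proj₂ (x∈p∩q⁻ _ _ x∈Aₛ))) ,
    λ a b a∈Aₛ b∈Aₛ a≢b r →
      incomparable a b (proj₁ (x∈p∩q⁻ _ _ a∈Aₛ)) (proj₁ (x∈p∩q⁻ _ _ b∈Aₛ)) a≢b
                   (Reaches-weaken s≤t r)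

  Support⇒InG : ∀ {t u} → Support E t u → InG E t u
  Support⇒InG (A , ((inG , _) , _) , u∈A) = inG _ u∈A

  module _ (top : IsTopOrder E) where

    Reaches⇒≤ : ∀ {t u v} → Reaches E t u v → toℕ u ≤ toℕ v
    Reaches⇒≤ (here _)     = ≤-refl
    Reaches⇒≤ (step _ e r) = <⇒≤ (<-≤-trans (top _ _ e) (Reaches⇒≤ r))

    Reaches⇒≡⊎< : ∀ {t u v} → Reaches E t u v → u ≡ v ⊎ toℕ u < toℕ v
    Reaches⇒≡⊎< (here _)     = inj₁ refl
    Reaches⇒≡⊎< (step _ e r) = inj₂ (<-≤-trans (top _ _ e) (Reaches⇒≤ r))

    Reaches-strengthen : ∀ {s t u v} → toℕ v < s → Reaches E t u v → Reaches E s u v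
    Reaches-strengthen v<s (here _)         = here v<s
    Reaches-strengthen v<s r@(step _ e r′) =
      step (≤-<-trans (Reaches⇒≤ r) v<s) e (Reaches-strengthen v<s r′)

    module Extension {s t A B} (s≤t : s ≤ t) (antiA : Antichain E t A) (antiB : Antichain E s B)
                     (dom : Dominates E s B (A ∩ Prefix s)) where

      Extended : Subset n
      Extended = B ∪ (A ∩ ∁ (Prefix s))

      ∈Extended⁻ : ∀ {x} → x ∈ Extended → x ∈ B ⊎ (x ∈ A × ¬ toℕ x < s)
      ∈Extended⁻ x∈C with x∈p∪q⁻ B _ x∈C
      ... | inj₁ x∈B     = inj₁ x∈B
      ... | inj₂ x∈A∖Aₛ with x∈p∩q⁻ A _ x∈A∖Aₛ
      ...   | x∈A , x∈∁P = inj₂ (x∈A , x∈∁p⇒x∉p x∈∁P ∘ ∈Prefix⁺)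

      Extended-antichain : Antichain E t Extended
      Extended-antichain = inG , incomparable
        where
        inG : ∀ x → x ∈ Extended → InG E t x
        inG x x∈C with ∈Extended⁻ x∈C
        ... | inj₁ x∈B       = <-≤-trans (proj₁ antiB x x∈B) s≤t
        ... | inj₂ (x∈A , _) = proj₁ antiA x x∈A

        incomparable : ∀ a b → a ∈ Extended → b ∈ Extended → a ≢ b → ¬ Reaches E t a b
        incomparable a b a∈C b∈C a≢b r with ∈Extended⁻ a∈C | ∈Extended⁻ b∈C
        ... | inj₁ a∈B | inj₁ b∈B =
          proj₂ antiB a b a∈B b∈B a≢b (Reaches-strengthen (proj₁ antiB b b∈B) r)
        ... | inj₁ a∈B | inj₂ (b∈A , b≮s) with proj₂ dom a a∈B
        ...   | a′ , a′∈Aₛ , a′↝a with x∈p∩q⁻ A _ a′∈Aₛ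
        ...     | a′∈A , a′∈P =
          proj₂ antiA a′ b a′∈A b∈A (λ { refl → b≮s (∈Prefix⁻ a′∈P) })
                (Reaches-trans (Reaches-weaken s≤t a′↝a) r)
        incomparable a b a∈C b∈C a≢b r | inj₂ (_ , a≮s) | inj₁ b∈B =
          a≮s (≤-<-trans (Reaches⇒≤ r) (proj₁ antiB b b∈B))
        incomparable a b a∈C b∈C a≢b r | inj₂ (a∈A , _) | inj₂ (b∈A , _) =
          proj₂ antiA a b a∈A b∈A a≢b r

      Extended-dominates : Dominates E t Extended A
      Extended-dominates = size , reached
        where
        disjoint : Empty (B ∩ (A ∩ ∁ (Prefix s)))
        disjoint (x , x∈B∩A∖Aₛ) with x∈p∩q⁻ B _ x∈B∩A∖Aₛ
        ... | x∈B , x∈A∖Aₛ =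
          x∈∁p⇒x∉p (proj₂ (x∈p∩q⁻ A _ x∈A∖Aₛ)) (∈Prefix⁺ (proj₁ antiB x x∈B))

        size : ∣ A ∣ ≡ ∣ Extended ∣
        size = begin
          ∣ A ∣                                     ≡⟨ ∣p∣≡∣p∩q∣+∣p∩∁q∣ A (Prefix s) ⟩
          ∣ A ∩ Prefix s ∣ + ∣ A ∩ ∁ (Prefix s) ∣     ≡⟨ cong (_+ ∣ A ∩ ∁ (Prefix s) ∣) (proj₁ dom) ⟩
          ∣ B ∣ + ∣ A ∩ ∁ (Prefix s) ∣                ≡⟨ ∣p∪q∣≡∣p∣+∣q∣ B _ disjoint ⟨
          ∣ Extended ∣                              ∎
          where open ≡-Reasoning

        reached : ∀ c → c ∈ Extended → SetReaches E t A c
        reached c c∈C with ∈Extended⁻ c∈C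
        ... | inj₂ (c∈A , _) = c , c∈A , here (proj₁ antiA c c∈A)
        ... | inj₁ c∈B with proj₂ dom c c∈B
        ...   | a , a∈Aₛ , a↝c = a , proj₁ (x∈p∩q⁻ A _ a∈Aₛ) , Reaches-weaken s≤t a↝c

      Extended≡A⇒B≡Aₛ : Extended ≡ A → B ≡ A ∩ Prefix s
      Extended≡A⇒B≡Aₛ C≡A = ⊆-antisym B⊆Aₛ Aₛ⊆B
        where
        B⊆Aₛ : B ⊆ A ∩ Prefix s
        B⊆Aₛ {x} x∈B =
          x∈p∩q⁺ (subst (x ∈_) C≡A (x∈p∪q⁺ (inj₁ x∈B)) , ∈Prefix⁺ (proj₁ antiB x x∈B))

        Aₛ⊆B : A ∩ Prefix s ⊆ B
        Aₛ⊆B {x} x∈Aₛ with x∈p∩q⁻ A _ x∈Aₛ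
        ... | x∈A , x∈P with ∈Extended⁻ (subst (x ∈_) (sym C≡A) x∈A)
        ...   | inj₁ x∈B      = x∈B
        ...   | inj₂ (_ , x≮s) = contradiction (∈Prefix⁻ x∈P) x≮s

    Frontier-restrict : ∀ {s t A} → s ≤ t → Frontier E t A → Frontier E s (A ∩ Prefix s)
    Frontier-restrict s≤t (antiA , undominated) =
      Antichain-restrict s≤t antiA , λ B antiB B≢Aₛ dom →
        let open Extension s≤t antiA antiB dom
        in undominated Extended Extended-antichain (B≢Aₛ ∘ Extended≡A⇒B≡Aₛ) Extended-dominates

    Support-restrict : ∀ {s t u} → s ≤ t → InG E s u → Support E t u → Support E s u
    Support-restrict {s} s≤t u<s (A , frontier , u∈A) =
      A ∩ Prefix s , Frontier-restrict s≤t frontier , x∈p∩q⁺ (u∈A , ∈Prefix⁺ u<s)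

theorem3 : (n : ℕ) (E : Graph n) → IsTopOrder E → (i u : Fin n) →
    Support E (toℕ i) u →
    (Reaches E n u i ⇔
      (E u i ⊎
        (∃ λ j → E j i × (Support E (toℕ i) u × Support E (toℕ j) u) × Reaches E n u j)))
theorem3 n E top i u u∈Sᵢ = mk⇔ necessary sufficient
  where
  ViaInNeighbour : Set
  ViaInNeighbour =
    E u i ⊎ (∃ λ j → E j i × (Support E (toℕ i) u × Support E (toℕ j) u) × Reaches E n u j)

  necessary : Reaches E n u i → ViaInNeighbour
  necessary u↝i with Reaches⇒≡⊎lastEdge E u↝i
  ... | inj₁ refl = contradiction (Support⇒InG E u∈Sᵢ) (<-irrefl refl)
  ... | inj₂ (j , u↝j , j→i) with Reaches⇒≡⊎< E top u↝j
  ...   | inj₁ refl = inj₁ j→i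
  ...   | inj₂ u<j  =
    inj₂ (j , j→i , (u∈Sᵢ , Support-restrict E top (<⇒≤ (top j i j→i)) u<j u∈Sᵢ) , u↝j)

  sufficient : ViaInNeighbour → Reaches E n u i
  sufficient (inj₁ u→i) = step (toℕ<n u) u→i (here (toℕ<n i))
  sufficient (inj₂ (j , j→i , _ , u↝j)) =
    Reaches-trans E u↝j (step (toℕ<n j) j→i (here (toℕ<n i)))
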